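{- Let $\mathcal K$ be the class of all graphs $Y(G)$ and $\tilde Y(G)$, where $G$ ranges over the connected graphs with at least two vertices in which every vertex has degree at least $3$. There is a first-order formula $\mathit{same\text{ - }color}(x,y)$ in the language $\{E\}$ of graphs such that for every such $G$ and all vertices $x,y$ of $Y(G)$ we have $Y(G)\models \mathit{same\text{ - }color}(x,y)$ if and only if $x$ and $y$ have the same color in $X(G)$, and for all vertices $x,y$ of $\tilde Y(G)$ we have $\tilde Y(G)\models \mathit{same\text{ - }color}(x,y)$ if and only if $x$ and $y$ have the same color in $\tilde X(G)$.
   Context: All graphs are finite, simple and undirected. Let $G$ be a connected graph with at least two vertices. For each vertex $u$ of $G$ let $A(u)=\{a(u,v): uv\in E(G)\}$ and $B(u)=\{b(u,v): uv\in E(G)\}$ be sets of new pairwise distinct elements, and let $M(u)$ be the set of all subsets of $A(u)$ of even cardinality, each regarded as a new vertex (middle vertices). The gadget $Y(u)$ has vertex set $A(u)\cup B(u)\cup M(u)$ and, for $m\in M(u)$, the edge $\{a(u,v),m\}$ if $a(u,v)\in m$ and the edge $\{b(u,v),m\}$ if $a(u,v)\notin m$. The vertices in $L(u)=A(u)\cup B(u)$ are link vertices. The uncolored CFI-graph $Y(G)$ is the disjoint union of all gadgets $Y(u)$, $u\in V(G)$, together with, for each edge $uv\in E(G)$, the two edges $\{a(u,v),a(v,u)\}$ and $\{b(u,v),b(v,u)\}$. The graph $\tilde Y(G)$ is obtained from $Y(G)$ by choosing one edge $u_0v_0$ of $G$ and replacing the edges $\{a(u_0,v_0),a(v_0,u_0)\}$,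 $\{b(u_0,v_0),b(v_0,u_0)\}$ by $\{a(u_0,v_0),b(v_0,u_0)\}$, $\{b(u_0,v_0),a(v_0,u_0)\}$ (up to isomorphism this does not depend on the chosen edge). The colored CFI-graph $X(G)$ (resp. $\tilde X(G)$) is $Y(G)$ (resp. $\tilde Y(G)$) with a vertex coloring in which two vertices $x,y$ have the same color if and only if they lie in the same gadget $Y(u)$ and either $x=y$, or both are middle vertices of $Y(u)$, or $\{x,y\}=\{a(u,v),b(u,v)\}$ for some neighbor $v$ of $u$. -}

module Defs where

open import Data.Nat using (ℕ; zero; suc; _≤_)
open import Data.Bool using (Bool; true; false; T; not; _∧_)
open import Data.Fin using (Fin; zero; suc)
open import Data.Vec using (Vec; []; _∷_; lookup; tabulate)
open import Data.Fin.Subset using (Subset; ∣_∣)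
open import Data.Product using (Σ; _×_; _,_)
open import Data.Sum using (_⊎_)
open import Data.Empty using (⊥)
open import Data.Unit using (⊤)
open import Data.Maybe using (Maybe; just; nothing)
open import Relation.Binary.PropositionalEquality using (_≡_)
open import Relation.Nullary using (¬_)

record Graph : Set where
  field
    n      : ℕ
    adj    : Fin n → Fin n → Bool
    sym    : ∀ u v → adj u v ≡ adj v u
    irrefl : ∀ u → adj u u ≡ false

open Graph public

data Reachable (G : Graph) : Fin (n G) → Fin (n G) → Set where
  here : ∀ {u} → Reachable G u u
  step : ∀ {u v w} → T (adj G u v) → Reachable G v w → Reachable G u w

Connected : Graph → Set
Connected G = ∀ u v → Reachable G u v

nbrs : (G : Graph) → Fin (n G) → Subset (n G)
nbrs G u = tabulate (adj G u)

degree : (G : Graph) → Fin (n G) → ℕ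
degree G u = ∣ nbrs G u ∣

MinDegree3 : Graph → Set
MinDegree3 G = ∀ u → 3 ≤ degree G u

-- First-order logic in the language {E} of graphs
-- (formulas with free variables among Fin k, de Bruijn style)

data Formula : ℕ → Set where
  _≐_  : ∀ {k} → Fin k → Fin k → Formula k
  E    : ∀ {k} → Fin k → Fin k → Formula k
  ⊤f   : ∀ {k} → Formula k
  ⊥f   : ∀ {k} → Formula k
  ¬f   : ∀ {k} → Formula k → Formula k
  _∧f_ : ∀ {k} → Formula k → Formula k → Formula k
  _∨f_ : ∀ {k} → Formula k → Formula k → Formula k
  _⇒f_ : ∀ {k} → Formula k → Formula k → Formula k
  ∃f   : ∀ {k} → Formula (suc k) → Formula k
  ∀f   : ∀ {k} → Formula (suc k) → Formula k

record Structure : Set₁ where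
  field
    Carrier : Set
    Edge    : Carrier → Carrier → Set

open Structure public

extend : {A : Set} {k : ℕ} → A → (Fin k → A) → Fin (suc k) → A
extend a ρ zero    = a
extend a ρ (suc i) = ρ i

Sat : (S : Structure) {k : ℕ} → Formula k → (Fin k → Carrier S) → Set
Sat S (i ≐ j)   ρ = ρ i ≡ ρ j
Sat S (E i j)   ρ = Edge S (ρ i) (ρ j)
Sat S ⊤f        ρ = ⊤
Sat S ⊥f        ρ = ⊥
Sat S (¬f φ)    ρ = ¬ Sat S φ ρ
Sat S (φ ∧f ψ)  ρ = Sat S φ ρ × Sat S ψ ρ
Sat S (φ ∨f ψ)  ρ = Sat S φ ρ ⊎ Sat S ψ ρ
Sat S (φ ⇒f ψ)  ρ = Sat S φ ρ → Sat S ψ ρ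
Sat S (∃f φ)    ρ = Σ (Carrier S) (λ a → Sat S φ (extend a ρ))
Sat S (∀f φ)    ρ = (a : Carrier S) → Sat S φ (extend a ρ)

env2 : {A : Set} → A → A → Fin 2 → A
env2 x y zero       = x
env2 x y (suc zero) = y

evenB : ℕ → Bool
evenB zero          = true
evenB (suc zero)    = false
evenB (suc (suc m)) = evenB m

subsetB : ∀ {m} → Subset m → Subset m → Bool
subsetB []          []          = true
subsetB (true ∷ s)  (b ∷ t)     = b ∧ subsetB s t
subsetB (false ∷ s) (_ ∷ t)     = subsetB s t

-- S (a set of neighbours v of u, i.e. of link vertices a(u,v)) is
-- an even-cardinality subset of A(u)
EvenSubsetOfA : (G : Graph) → Fin (n G) → Subset (n G) → Bool
EvenSubsetOfA G u S = subsetB S (nbrs G u) ∧ evenB ∣ S ∣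

-- vertices of Y(G):  a(u,v), b(u,v) for uv ∈ E(G), and middle vertices
-- m(u,S) for S ⊆ A(u) even (S given as the set of v with a(u,v) ∈ S)
data YVertex (G : Graph) : Set where
  aV : (u v : Fin (n G)) → T (adj G u v) → YVertex G
  bV : (u v : Fin (n G)) → T (adj G u v) → YVertex G
  mV : (u : Fin (n G)) (S : Subset (n G)) → T (EvenSubsetOfA G u S) → YVertex G

-- optional twisted edge u0v0; nothing gives Y(G), just (u0 , v0) gives Ỹ(G)
Twisted : (G : Graph) → Maybe (Fin (n G) × Fin (n G)) → Fin (n G) → Fin (n G) → Set
Twisted G nothing          u v = ⊥
Twisted G (just (u0 , v0)) u v = (u ≡ u0 × v ≡ v0) ⊎ (u ≡ v0 × v ≡ u0)

YEdge : (G : Graph) → Maybe (Fin (n G) × Fin (n G)) → YVertex G → YVertex G → Set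
YEdge G tw (aV u v _) (mV w S _) = u ≡ w × T (lookup S v)
YEdge G tw (mV w S _) (aV u v _) = u ≡ w × T (lookup S v)
YEdge G tw (bV u v _) (mV w S _) = u ≡ w × T (not (lookup S v))
YEdge G tw (mV w S _) (bV u v _) = u ≡ w × T (not (lookup S v))
YEdge G tw (aV u v _) (aV u' v' _) = u' ≡ v × v' ≡ u × ¬ Twisted G tw u v
YEdge G tw (bV u v _) (bV u' v' _) = u' ≡ v × v' ≡ u × ¬ Twisted G tw u v
YEdge G tw (aV u v _) (bV u' v' _) = u' ≡ v × v' ≡ u × Twisted G tw u v
YEdge G tw (bV u v _) (aV u' v' _) = u' ≡ v × v' ≡ u × Twisted G tw u v
YEdge G tw (mV _ _ _) (mV _ _ _) = ⊥

Y : Graph → Structure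
Y G = record { Carrier = YVertex G ; Edge = YEdge G nothing }

Ytilde : (G : Graph) → Fin (n G) → Fin (n G) → Structure
Ytilde G u0 v0 = record { Carrier = YVertex G ; Edge = YEdge G (just (u0 , v0)) }

-- the colouring of X(G) / X̃(G) (same on both; vertex set shared)
SameColor : (G : Graph) → YVertex G → YVertex G → Set
SameColor G (aV u v _) (aV u' v' _) = u ≡ u' × v ≡ v'
SameColor G (aV u v _) (bV u' v' _) = u ≡ u' × v ≡ v'
SameColor G (bV u v _) (aV u' v' _) = u ≡ u' × v ≡ v'
SameColor G (bV u v _) (bV u' v' _) = u ≡ u' × v ≡ v'
SameColor G (mV u _ _) (mV u' _ _)  = u ≡ u'
SameColor G (aV _ _ _) (mV _ _ _)   = ⊥
SameColor G (bV _ _ _) (mV _ _ _)   = ⊥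
SameColor G (mV _ _ _) (aV _ _ _)   = ⊥
SameColor G (mV _ _ _) (bV _ _ _)   = ⊥

-- An edge joining two gadgets lies on no closed walk of the shape hexagonᶠ, while every edge at
-- a middle vertex m(u,S) does: since u has two further neighbours w₁, w₂, toggling S at {w₁,w₂}
-- and at {v,w₁} yields such a walk inside Y(u). So link and middle vertices are first-order
-- definable, and a link x lies in the gadget of a middle vertex h iff x – m – l – h with m middle.
-- Two middle vertices have the same colour iff they have link neighbours in a common gadget; two
-- links have the same colour iff they lie in a common gadget and so do their unique link
-- neighbours. The twist only permutes link–link edges, so the same formula works for Ỹ(G).
module Submission where

open import Defs renaming (sym to adj-sym)
open import Data.Nat using (zero; suc; _≤_; _<_; _+_; s≤s; z≤n)
open import Data.Nat.Properties using (≤-trans; ≤-reflexive; ≤-pred; m≤n⇒m≤1+n; +-suc)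
open import Data.Bool using (Bool; true; false; T; not; _∧_)
open import Data.Bool.Properties using (T-∧; T-≡; T-not-≡; T-irrelevant; not-involutive; not-¬; ¬-not)
import Data.Bool.Properties as Bool
open import Data.Fin using (Fin; zero; suc; #_; _↑ʳ_)
open import Data.Fin.Properties using (_≟_)
open import Data.Fin.Subset using (Subset; inside; outside; ∣_∣; _∈_; _∉_; _─_; _-_; ⁅_⁆; Nonempty)
  renaming (⊥ to ∅)
open import Data.Fin.Subset.Properties using (p─q⊆p; x∉⁅y⁆⇒x≢y; ∣⁅x⁆∣≡1; ∣⊥∣≡0)
open import Data.Vec using ([]; _∷_; here; there; lookup; updateAt)
open import Data.Vec.Properties using (lookup∘tabulate; lookup∘updateAt; lookup∘updateAt′; []=⇒lookup)
open import Data.Maybe using (Maybe; just; nothing)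
open import Data.Product using (Σ; ∃-syntax; _×_; _,_; proj₁; proj₂)
open import Data.Sum using (_⊎_; inj₁; inj₂; [_,_]′)
open import Data.Empty using (⊥-elim)
open import Data.Unit using (tt)
open import Function using (_∘_)
open import Function.Bundles using (_⇔_; mk⇔; Equivalence)
open import Relation.Nullary using (¬_; Dec; yes; no)
open import Relation.Nullary.Decidable using (_×-dec_; _⊎-dec_)
open import Relation.Binary.PropositionalEquality
  using (_≡_; _≢_; refl; sym; trans; cong; subst; module ≡-Reasoning)

∣p∣≤∣q∣+∣p─q∣ : ∀ {n} (p q : Subset n) → ∣ p ∣ ≤ ∣ q ∣ + ∣ p ─ q ∣
∣p∣≤∣q∣+∣p─q∣ []            []            = z≤n
∣p∣≤∣q∣+∣p─q∣ (outside ∷ p) (outside ∷ q) = ∣p∣≤∣q∣+∣p─q∣ p q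
∣p∣≤∣q∣+∣p─q∣ (outside ∷ p) (inside  ∷ q) = m≤n⇒m≤1+n (∣p∣≤∣q∣+∣p─q∣ p q)
∣p∣≤∣q∣+∣p─q∣ (inside  ∷ p) (outside ∷ q) =
  ≤-trans (s≤s (∣p∣≤∣q∣+∣p─q∣ p q)) (≤-reflexive (sym (+-suc ∣ q ∣ ∣ p ─ q ∣)))
∣p∣≤∣q∣+∣p─q∣ (inside  ∷ p) (inside  ∷ q) = s≤s (∣p∣≤∣q∣+∣p─q∣ p q)

∣p∣≤1+∣p-x∣ : ∀ {n} (p : Subset n) x → ∣ p ∣ ≤ suc ∣ p - x ∣
∣p∣≤1+∣p-x∣ p x = subst (λ k → ∣ p ∣ ≤ k + ∣ p - x ∣) (∣⁅x⁆∣≡1 x) (∣p∣≤∣q∣+∣p─q∣ p ⁅ x ⁆)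

0<∣p∣⇒Nonempty : ∀ {n} (p : Subset n) → 0 < ∣ p ∣ → Nonempty p
0<∣p∣⇒Nonempty (inside  ∷ p) _   = zero , here
0<∣p∣⇒Nonempty (outside ∷ p) 0<∣p∣ with 0<∣p∣⇒Nonempty p 0<∣p∣
... | x , x∈p = suc x , there x∈p

x∈p─q⇒x∉q : ∀ {n} {x : Fin n} (p q : Subset n) → x ∈ p ─ q → x ∉ q
x∈p─q⇒x∉q (inside ∷ p) (outside ∷ q) here       ()
x∈p─q⇒x∉q (_      ∷ p) (_       ∷ q) (there x∈) (there x∈q) = x∈p─q⇒x∉q p q x∈ x∈q

x∈p-y⇒x≢y : ∀ {n} {x y : Fin n} (p : Subset n) → x ∈ p - y → x ≢ y
x∈p-y⇒x≢y {y = y} p x∈p-y = x∉⁅y⁆⇒x≢y (x∈p─q⇒x∉q p ⁅ y ⁆ x∈p-y)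

avoid₂ : ∀ {n} (p : Subset n) (a b : Fin n) → 3 ≤ ∣ p ∣ → ∃[ x ] x ∈ p × x ≢ a × x ≢ b
avoid₂ p a b 3≤∣p∣ with 0<∣p∣⇒Nonempty (p - a - b) 0<∣p-a-b∣
  where
    0<∣p-a-b∣ : 0 < ∣ p - a - b ∣
    0<∣p-a-b∣ = ≤-pred (≤-pred (≤-trans 3≤∣p∣
      (≤-trans (∣p∣≤1+∣p-x∣ p a) (s≤s (∣p∣≤1+∣p-x∣ (p - a) b)))))
... | x , x∈p-a-b = x , p─q⊆p p ⁅ a ⁆ x∈p-a , x∈p-y⇒x≢y p x∈p-a , x∈p-y⇒x≢y (p - a) x∈p-a-b
  where x∈p-a = p─q⊆p (p - a) ⁅ b ⁆ x∈p-a-b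

T⇒¬T-not : ∀ {b} → T b → ¬ T (not b)
T⇒¬T-not {true} _ ()

toggle : ∀ {n} → Subset n → Fin n → Subset n
toggle S i = updateAt S i not

lookup-toggle : ∀ {n} (S : Subset n) i → lookup (toggle S i) i ≡ not (lookup S i)
lookup-toggle S i = lookup∘updateAt i S

lookup-toggle′ : ∀ {n} (S : Subset n) {i j} → i ≢ j → lookup (toggle S j) i ≡ lookup S i
lookup-toggle′ S {i} {j} i≢j = lookup∘updateAt′ i j i≢j S

evenB-suc : ∀ k → evenB (suc k) ≡ not (evenB k)
evenB-suc zero          = refl
evenB-suc (suc zero)    = refl
evenB-suc (suc (suc k)) = evenB-suc k

evenB-∣toggle∣ : ∀ {n} (S : Subset n) i → evenB ∣ toggle S i ∣ ≡ not (evenB ∣ S ∣)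
evenB-∣toggle∣ (inside  ∷ S) zero    = sym (trans (cong not (evenB-suc ∣ S ∣)) (not-involutive _))
evenB-∣toggle∣ (outside ∷ S) zero    = evenB-suc ∣ S ∣
evenB-∣toggle∣ (inside  ∷ S) (suc i) = begin
  evenB (suc ∣ toggle S i ∣) ≡⟨ evenB-suc ∣ toggle S i ∣ ⟩
  not (evenB ∣ toggle S i ∣) ≡⟨ cong not (evenB-∣toggle∣ S i) ⟩
  not (not (evenB ∣ S ∣))    ≡⟨ cong not (evenB-suc ∣ S ∣) ⟨
  not (evenB (suc ∣ S ∣))    ∎
  where open ≡-Reasoning
evenB-∣toggle∣ (outside ∷ S) (suc i) = evenB-∣toggle∣ S i

subsetB-toggle : ∀ {n} (s t : Subset n) i → T (lookup t i) → T (subsetB s t) → T (subsetB (toggle s i) t)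
subsetB-toggle (inside  ∷ s) (_      ∷ t) zero    _   s⊆t = proj₂ (Equivalence.to T-∧ s⊆t)
subsetB-toggle (outside ∷ s) (inside ∷ t) zero    _   s⊆t = s⊆t
subsetB-toggle (inside  ∷ s) (inside ∷ t) (suc i) i∈t s⊆t = subsetB-toggle s t i i∈t s⊆t
subsetB-toggle (outside ∷ s) (_      ∷ t) (suc i) i∈t s⊆t = subsetB-toggle s t i i∈t s⊆t

subsetB-∅ : ∀ {n} (t : Subset n) → T (subsetB ∅ t)
subsetB-∅ []      = tt
subsetB-∅ (_ ∷ t) = subsetB-∅ t

module _ (G : Graph) where

  ∅-even : ∀ u → T (EvenSubsetOfA G u ∅)
  ∅-even u = Equivalence.from T-∧ (subsetB-∅ (nbrs G u) , subst (T ∘ evenB) (sym (∣⊥∣≡0 (n G))) tt)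

  toggle₂-even : ∀ {u} S {a b} → T (EvenSubsetOfA G u S) → T (adj G u a) → T (adj G u b) →
                 T (EvenSubsetOfA G u (toggle (toggle S a) b))
  toggle₂-even {u} S {a} {b} S-even ua ub = Equivalence.from T-∧ (S′⊆A , subst T (sym parity) S-even-card)
    where
      S⊆A = proj₁ (Equivalence.to T-∧ S-even)
      S-even-card = proj₂ (Equivalence.to T-∧ S-even)
      nbr : ∀ {w} → T (adj G u w) → T (lookup (nbrs G u) w)
      nbr {w} = subst T (sym (lookup∘tabulate (adj G u) w))
      S′⊆A = subsetB-toggle (toggle S a) (nbrs G u) b (nbr ub) (subsetB-toggle S (nbrs G u) a (nbr ua) S⊆A)
      parity : evenB ∣ toggle (toggle S a) b ∣ ≡ evenB ∣ S ∣
      parity = begin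
        evenB ∣ toggle (toggle S a) b ∣ ≡⟨ evenB-∣toggle∣ (toggle S a) b ⟩
        not (evenB ∣ toggle S a ∣)      ≡⟨ cong not (evenB-∣toggle∣ S a) ⟩
        not (not (evenB ∣ S ∣))         ≡⟨ not-involutive _ ⟩
        evenB ∣ S ∣                     ∎
        where open ≡-Reasoning

  neighbour-avoiding : MinDegree3 G → ∀ u a b → ∃[ w ] T (adj G u w) × w ≢ a × w ≢ b
  neighbour-avoiding deg3 u a b with avoid₂ (nbrs G u) a b (deg3 u)
  ... | w , w∈N , w≢a , w≢b = w , uw , w≢a , w≢b
    where
      uw : T (adj G u w)
      uw = Equivalence.from T-≡ (trans (sym (lookup∘tabulate (adj G u) w)) ([]=⇒lookup w∈N))

  neighbour : MinDegree3 G → ∀ u → ∃[ v ] T (adj G u v)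
  neighbour deg3 u with neighbour-avoiding deg3 u u u
  ... | v , uv , _ = v , uv

module _ {G : Graph} where

  data IsLink : YVertex G → Set where
    isA : ∀ {u v q} → IsLink (aV u v q)
    isB : ∀ {u v q} → IsLink (bV u v q)

  data IsMiddle : YVertex G → Set where
    isM : ∀ {u S p} → IsMiddle (mV u S p)

  link-or-middle : ∀ x → IsLink x ⊎ IsMiddle x
  link-or-middle (aV _ _ _) = inj₁ isA
  link-or-middle (bV _ _ _) = inj₁ isB
  link-or-middle (mV _ _ _) = inj₂ isM

  gadget : YVertex G → Fin (n G)
  gadget (aV u _ _) = u
  gadget (bV u _ _) = u
  gadget (mV u _ _) = u

  -- the other end of the edge a(u,v) / b(u,v) stands for; junk value u on middle vertices
  peer : YVertex G → Fin (n G)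
  peer (aV _ v _) = v
  peer (bV _ v _) = v
  peer (mV u _ _) = u

  link : Bool → (u v : Fin (n G)) → T (adj G u v) → YVertex G
  link true  = aV
  link false = bV

  link-peer-injective : ∀ {b b′ u u′ v v′ q q′} → link b u v q ≡ link b′ u′ v′ q′ → v ≡ v′
  link-peer-injective {true}  {true}  refl = refl
  link-peer-injective {false} {false} refl = refl
  link-peer-injective {true}  {false} ()
  link-peer-injective {false} {true}  ()

  mV-injective : ∀ {u u′ S S′ p p′} → mV {G} u S p ≡ mV u′ S′ p′ → S ≡ S′
  mV-injective refl = refl

Twisted-sym : ∀ {G tw u v} → Twisted G tw u v → Twisted G tw v u
Twisted-sym {tw = just _} (inj₁ (u≡u₀ , v≡v₀)) = inj₂ (v≡v₀ , u≡u₀)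
Twisted-sym {tw = just _} (inj₂ (u≡v₀ , v≡u₀)) = inj₁ (v≡u₀ , u≡v₀)

Twisted? : ∀ G tw u v → Dec (Twisted G tw u v)
Twisted? G nothing          u v = no λ ()
Twisted? G (just (u₀ , v₀)) u v = (u ≟ u₀ ×-dec v ≟ v₀) ⊎-dec (u ≟ v₀ ×-dec v ≟ u₀)

-- A closed walk p x₂ x₃ x₄ x₅ x through the edge xp, not necessarily a cycle: only the
-- backtracking steps x₂ = x, x₅ = p and x₃ = p are excluded.
hexagonᶠ : ∀ {k} → Fin k → Fin k → Formula k
hexagonᶠ x p = ∃f (∃f (∃f (∃f
    (E p′ x₂ ∧f (E x₂ x₃ ∧f (E x₃ x₄ ∧f (E x₄ x₅ ∧f (E x₅ x′
    ∧f (¬f (x₂ ≐ x′) ∧f (¬f (x₅ ≐ p′) ∧f ¬f (x₃ ≐ p′)))))))))))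
  where
    x′ = 4 ↑ʳ x
    p′ = 4 ↑ʳ p
    x₂ = # 3
    x₃ = # 2
    x₄ = # 1
    x₅ = # 0

linkᶠ : ∀ {k} → Fin k → Formula k
linkᶠ x = ∃f (E (suc x) zero ∧f ¬f (hexagonᶠ (suc x) zero))

middleᶠ : ∀ {k} → Fin k → Formula k
middleᶠ x = ¬f (linkᶠ x)

inGadgetᶠ : ∀ {k} → Fin k → Fin k → Formula k
inGadgetᶠ x h = ∃f (∃f (E x′ p ∧f (middleᶠ p ∧f (E p q ∧f (E q h′ ∧f middleᶠ h′)))))
  where
    x′ = 2 ↑ʳ x
    h′ = 2 ↑ʳ h
    p = # 1
    q = # 0

sameLinkColorᶠ : ∀ {k} → Fin k → Fin k → Formula k
sameLinkColorᶠ x y = linkᶠ x ∧f (linkᶠ y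
  ∧f (∃f (inGadgetᶠ (suc x) zero ∧f inGadgetᶠ (suc y) zero)
  ∧f ∃f (∃f (∃f (E x′ p ∧f (linkᶠ p ∧f (E y′ q ∧f (linkᶠ q ∧f (inGadgetᶠ p h ∧f inGadgetᶠ q h)))))))))
  where
    x′ = 3 ↑ʳ x
    y′ = 3 ↑ʳ y
    p = # 2
    q = # 1
    h = # 0

sameMiddleColorᶠ : ∀ {k} → Fin k → Fin k → Formula k
sameMiddleColorᶠ x y = middleᶠ x ∧f (middleᶠ y
  ∧f ∃f (∃f (∃f (E x′ l ∧f (E y′ l′ ∧f (inGadgetᶠ l h ∧f inGadgetᶠ l′ h))))))
  where
    x′ = 3 ↑ʳ x
    y′ = 3 ↑ʳ y
    l = # 2
    l′ = # 1
    h = # 0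

sameColorᶠ : Formula 2
sameColorᶠ = sameLinkColorᶠ (# 0) (# 1) ∨f sameMiddleColorᶠ (# 0) (# 1)

module Meaning (S : Structure) where

  private
    V = Carrier S
    _~_ = Edge S

  ⟦hexagon⟧ : V → V → Set
  ⟦hexagon⟧ x p = Σ V λ x₂ → Σ V λ x₃ → Σ V λ x₄ → Σ V λ x₅ →
    p ~ x₂ × (x₂ ~ x₃ × (x₃ ~ x₄ × (x₄ ~ x₅ × (x₅ ~ x × (x₂ ≢ x × (x₅ ≢ p × x₃ ≢ p))))))

  ⟦link⟧ : V → Set
  ⟦link⟧ x = Σ V λ p → x ~ p × ¬ ⟦hexagon⟧ x p

  ⟦middle⟧ : V → Set
  ⟦middle⟧ x = ¬ ⟦link⟧ x

  ⟦inGadget⟧ : V → V → Set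
  ⟦inGadget⟧ x h = Σ V λ p → Σ V λ q → x ~ p × (⟦middle⟧ p × (p ~ q × (q ~ h × ⟦middle⟧ h)))

  ⟦sameLinkColor⟧ : V → V → Set
  ⟦sameLinkColor⟧ x y = ⟦link⟧ x × (⟦link⟧ y
    × ((Σ V λ h → ⟦inGadget⟧ x h × ⟦inGadget⟧ y h)
    × (Σ V λ p → Σ V λ q → Σ V λ h →
         x ~ p × (⟦link⟧ p × (y ~ q × (⟦link⟧ q × (⟦inGadget⟧ p h × ⟦inGadget⟧ q h)))))))

  ⟦sameMiddleColor⟧ : V → V → Set
  ⟦sameMiddleColor⟧ x y = ⟦middle⟧ x × (⟦middle⟧ y
    × (Σ V λ l → Σ V λ l′ → Σ V λ h → x ~ l × (y ~ l′ × (⟦inGadget⟧ l h × ⟦inGadget⟧ l′ h))))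

  Sat-sameColor : ∀ x y → Sat S sameColorᶠ (env2 x y) ≡ (⟦sameLinkColor⟧ x y ⊎ ⟦sameMiddleColor⟧ x y)
  Sat-sameColor x y = refl

module CFI (G : Graph) (deg3 : MinDegree3 G) (tw : Maybe (Fin (n G) × Fin (n G))) where

  Ỹ : Structure
  Ỹ = record { Carrier = YVertex G ; Edge = YEdge G tw }

  open Meaning Ỹ

  private
    V = YVertex G
    _~_ = YEdge G tw

  ~-sym : ∀ {x y} → x ~ y → y ~ x
  ~-sym {aV _ _ _} {aV _ _ _} (refl , refl , ¬t) = refl , refl , ¬t ∘ Twisted-sym
  ~-sym {aV _ _ _} {bV _ _ _} (refl , refl , t)  = refl , refl , Twisted-sym t
  ~-sym {bV _ _ _} {aV _ _ _} (refl , refl , t)  = refl , refl , Twisted-sym t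
  ~-sym {bV _ _ _} {bV _ _ _} (refl , refl , ¬t) = refl , refl , ¬t ∘ Twisted-sym
  ~-sym {aV _ _ _} {mV _ _ _} e = e
  ~-sym {bV _ _ _} {mV _ _ _} e = e
  ~-sym {mV _ _ _} {aV _ _ _} e = e
  ~-sym {mV _ _ _} {bV _ _ _} e = e

  middle~link : ∀ {u v b S} {q : T (adj G u v)} {pS : T (EvenSubsetOfA G u S)} →
                lookup S v ≡ b → mV u S pS ~ link b u v q
  middle~link {b = true}  Sv≡b = refl , Equivalence.from T-≡ Sv≡b
  middle~link {b = false} Sv≡b = refl , Equivalence.from T-not-≡ Sv≡b

  middle-neighbour : ∀ {m y} → IsMiddle m → m ~ y → IsLink y × gadget y ≡ gadget m
  middle-neighbour {y = aV _ _ _} isM (u≡w , _) = isA , u≡w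
  middle-neighbour {y = bV _ _ _} isM (u≡w , _) = isB , u≡w

  link~link : ∀ {x y} → IsLink x → IsLink y → x ~ y → gadget y ≡ peer x × peer y ≡ gadget x
  link~link isA isA (refl , refl , _) = refl , refl
  link~link isA isB (refl , refl , _) = refl , refl
  link~link isB isA (refl , refl , _) = refl , refl
  link~link isB isB (refl , refl , _) = refl , refl

  link-neighbour-unique : ∀ {p x x′} → IsLink p → IsLink x → IsLink x′ → p ~ x → p ~ x′ → x ≡ x′
  link-neighbour-unique isA isA isA (refl , refl , _)  (refl , refl , _) = cong (aV _ _) (T-irrelevant _ _)
  link-neighbour-unique isA isA isB (refl , refl , ¬t) (refl , refl , t) = ⊥-elim (¬t t)
  link-neighbour-unique isA isB isA (refl , refl , t)  (refl , refl , ¬t) = ⊥-elim (¬t t)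
  link-neighbour-unique isA isB isB (refl , refl , _)  (refl , refl , _) = cong (bV _ _) (T-irrelevant _ _)
  link-neighbour-unique isB isA isA (refl , refl , _)  (refl , refl , _) = cong (aV _ _) (T-irrelevant _ _)
  link-neighbour-unique isB isA isB (refl , refl , t)  (refl , refl , ¬t) = ⊥-elim (¬t t)
  link-neighbour-unique isB isB isA (refl , refl , ¬t) (refl , refl , t) = ⊥-elim (¬t t)
  link-neighbour-unique isB isB isB (refl , refl , _)  (refl , refl , _) = cong (bV _ _) (T-irrelevant _ _)

  -- a(u,v) and b(u,v) have no common middle neighbour
  middle-neighbour-unique : ∀ {m y y′} → IsMiddle m → m ~ y → m ~ y′ →
                            gadget y ≡ gadget y′ → peer y ≡ peer y′ → y ≡ y′
  middle-neighbour-unique {y = aV _ _ _} {aV _ _ _} isM (refl , _) (refl , _) refl refl =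
    cong (aV _ _) (T-irrelevant _ _)
  middle-neighbour-unique {y = bV _ _ _} {bV _ _ _} isM (refl , _) (refl , _) refl refl =
    cong (bV _ _) (T-irrelevant _ _)
  middle-neighbour-unique {y = aV _ _ _} {bV _ _ _} isM (refl , v∈S) (refl , v∉S) refl refl =
    ⊥-elim (T⇒¬T-not v∈S v∉S)
  middle-neighbour-unique {y = bV _ _ _} {aV _ _ _} isM (refl , v∉S) (refl , v∈S) refl refl =
    ⊥-elim (T⇒¬T-not v∈S v∉S)

  link-edge-off-hexagon : ∀ {x p} → IsLink x → IsLink p → x ~ p → ¬ ⟦hexagon⟧ x p
  link-edge-off-hexagon {x} {p} lx lp x~p (x₂ , x₃ , x₄ , x₅ , p~x₂ , x₂~x₃ , x₃~x₄ , x₄~x₅ , x₅~x , x₂≢x , x₅≢p , x₃≢p)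
    with link-or-middle x₂ | link-or-middle x₅
  ... | inj₁ l₂ | _      = x₂≢x (sym (link-neighbour-unique lp lx l₂ (~-sym x~p) p~x₂))
  ... | inj₂ _  | inj₁ l₅ = x₅≢p (sym (link-neighbour-unique lx lp l₅ x~p (~-sym x₅~x)))
  ... | inj₂ m₂ | inj₂ m₅ = x₃≢p (middle-neighbour-unique m₂ x₂~x₃ (~-sym p~x₂) same-gadget same-peer)
    where
      x₃-in-x₂ = middle-neighbour m₂ x₂~x₃
      x₄-in-x₅ = middle-neighbour m₅ (~-sym x₄~x₅)
      same-gadget : gadget x₃ ≡ gadget p
      same-gadget = trans (proj₂ x₃-in-x₂) (sym (proj₂ (middle-neighbour m₂ (~-sym p~x₂))))
      same-peer : peer x₃ ≡ peer p
      same-peer = begin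
        peer x₃   ≡⟨ proj₁ (link~link (proj₁ x₃-in-x₂) (proj₁ x₄-in-x₅) x₃~x₄) ⟨
        gadget x₄ ≡⟨ proj₂ x₄-in-x₅ ⟩
        gadget x₅ ≡⟨ proj₂ (middle-neighbour m₅ x₅~x) ⟨
        gadget x  ≡⟨ proj₂ (link~link lx lp x~p) ⟨
        peer p    ∎
        where open ≡-Reasoning

  -- link(v) ~ m(S₂) ~ link(w₁) ~ m(S₃) ~ link(w₂) ~ m(S), toggling S at {w₁,w₂} and at {v,w₁}
  hexagon-through : ∀ {u v w₁ w₂ S} (q : T (adj G u v)) (pS : T (EvenSubsetOfA G u S)) →
                    T (adj G u w₁) → T (adj G u w₂) → w₁ ≢ v → w₂ ≢ v → w₂ ≢ w₁ →
                    ⟦hexagon⟧ (mV u S pS) (link (lookup S v) u v q)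
  hexagon-through {u} {v} {w₁} {w₂} {S} q pS uw₁ uw₂ w₁≢v w₂≢v w₂≢w₁ =
    m₂ , x₃ , m₃ , x₅ ,
    ~-sym (middle~link S₂[v]) , middle~link refl , ~-sym (middle~link S₃[w₁]) ,
    middle~link S₃[w₂] , ~-sym (middle~link refl) ,
    m₂≢m , w₂≢v ∘ link-peer-injective , w₁≢v ∘ link-peer-injective
    where
      S₂ = toggle (toggle S w₁) w₂
      S₃ = toggle (toggle S v) w₁
      m₂ = mV u S₂ (toggle₂-even G S pS uw₁ uw₂)
      m₃ = mV u S₃ (toggle₂-even G S pS q uw₁)
      x₃ = link (lookup S₂ w₁) u w₁ uw₁
      x₅ = link (lookup S w₂) u w₂ uw₂
      S₂[v] : lookup S₂ v ≡ lookup S v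
      S₂[v] = trans (lookup-toggle′ (toggle S w₁) (w₂≢v ∘ sym)) (lookup-toggle′ S (w₁≢v ∘ sym))
      S₂[w₁] : lookup S₂ w₁ ≡ not (lookup S w₁)
      S₂[w₁] = trans (lookup-toggle′ (toggle S w₁) (w₂≢w₁ ∘ sym)) (lookup-toggle S w₁)
      S₃[w₁] : lookup S₃ w₁ ≡ lookup S₂ w₁
      S₃[w₁] = trans (lookup-toggle (toggle S v) w₁) (trans (cong not (lookup-toggle′ S w₁≢v)) (sym S₂[w₁]))
      S₃[w₂] : lookup S₃ w₂ ≡ lookup S w₂
      S₃[w₂] = trans (lookup-toggle′ (toggle S v) w₂≢w₁) (lookup-toggle′ S w₂≢v)
      m₂≢m : m₂ ≢ mV u S pS
      m₂≢m m₂≡m = not-¬ refl (trans (sym (cong (λ R → lookup R w₁) (mV-injective m₂≡m))) S₂[w₁])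

  middle-link-on-hexagon : ∀ {u v S} (q : T (adj G u v)) (pS : T (EvenSubsetOfA G u S)) →
                           ⟦hexagon⟧ (mV u S pS) (link (lookup S v) u v q)
  middle-link-on-hexagon {u} {v} q pS with neighbour-avoiding G deg3 u v v
  ... | w₁ , uw₁ , w₁≢v , _ with neighbour-avoiding G deg3 u v w₁
  ... | w₂ , uw₂ , w₂≢v , w₂≢w₁ = hexagon-through q pS uw₁ uw₂ w₁≢v w₂≢v w₂≢w₁

  middle-edge-on-hexagon : ∀ {m y} → IsMiddle m → m ~ y → ⟦hexagon⟧ m y
  middle-edge-on-hexagon {mV u S pS} {aV _ v q} isM (refl , v∈S) =
    subst (λ b → ⟦hexagon⟧ (mV u S pS) (link b u v q)) (Equivalence.to T-≡ v∈S) (middle-link-on-hexagon q pS)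
  middle-edge-on-hexagon {mV u S pS} {bV _ v q} isM (refl , v∉S) =
    subst (λ b → ⟦hexagon⟧ (mV u S pS) (link b u v q)) (Equivalence.to T-not-≡ v∉S) (middle-link-on-hexagon q pS)

  partner : ∀ {x} → IsLink x → ∃[ p ] x ~ p × IsLink p × gadget p ≡ peer x
  partner (isA {u} {v} {q}) with Twisted? G tw u v
  ... | yes t = bV v u (subst T (adj-sym G u v) q) , (refl , refl , t) , isB , refl
  ... | no ¬t = aV v u (subst T (adj-sym G u v) q) , (refl , refl , ¬t) , isA , refl
  partner (isB {u} {v} {q}) with Twisted? G tw u v
  ... | yes t = aV v u (subst T (adj-sym G u v) q) , (refl , refl , t) , isA , refl
  ... | no ¬t = bV v u (subst T (adj-sym G u v) q) , (refl , refl , ¬t) , isB , refl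

  IsLink⇒⟦link⟧ : ∀ {x} → IsLink x → ⟦link⟧ x
  IsLink⇒⟦link⟧ lx with partner lx
  ... | p , x~p , lp , _ = p , x~p , link-edge-off-hexagon lx lp x~p

  IsMiddle⇒⟦middle⟧ : ∀ {x} → IsMiddle x → ⟦middle⟧ x
  IsMiddle⇒⟦middle⟧ mx (p , x~p , off-hexagon) = off-hexagon (middle-edge-on-hexagon mx x~p)

  ⟦link⟧⇒IsLink : ∀ {x} → ⟦link⟧ x → IsLink x
  ⟦link⟧⇒IsLink {x} lx with link-or-middle x
  ... | inj₁ l = l
  ... | inj₂ m = ⊥-elim (IsMiddle⇒⟦middle⟧ m lx)

  ⟦middle⟧⇒IsMiddle : ∀ {x} → ⟦middle⟧ x → IsMiddle x
  ⟦middle⟧⇒IsMiddle {x} mx with link-or-middle x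
  ... | inj₁ l = ⊥-elim (mx (IsLink⇒⟦link⟧ l))
  ... | inj₂ m = m

  ⟦inGadget⟧⇒≡gadget : ∀ {x h} → ⟦inGadget⟧ x h → gadget x ≡ gadget h
  ⟦inGadget⟧⇒≡gadget {x} {h} (p , q , x~p , mp , p~q , q~h , mh) = begin
    gadget x ≡⟨ proj₂ (middle-neighbour (⟦middle⟧⇒IsMiddle mp) (~-sym x~p)) ⟩
    gadget p ≡⟨ proj₂ (middle-neighbour (⟦middle⟧⇒IsMiddle mp) p~q) ⟨
    gadget q ≡⟨ proj₂ (middle-neighbour (⟦middle⟧⇒IsMiddle mh) (~-sym q~h)) ⟩
    gadget h ∎
    where open ≡-Reasoning

  -- If S disagrees with b at v, go through m(S ⊕ {v,w}) and a link at a third neighbour x,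
  -- where both middle vertices agree.
  link-inGadget : ∀ b {u v S} (q : T (adj G u v)) (pS : T (EvenSubsetOfA G u S)) →
                  ⟦inGadget⟧ (link b u v q) (mV u S pS)
  link-inGadget b {u} {v} {S} q pS with lookup S v Bool.≟ b
  ... | yes S[v]≡b = m , l , ~-sym m~l , mm , m~l , ~-sym m~l , mm
    where
      m = mV u S pS
      l = link b u v q
      m~l = middle~link S[v]≡b
      mm = IsMiddle⇒⟦middle⟧ isM
  ... | no S[v]≢b with neighbour-avoiding G deg3 u v v
  ... | w , uw , w≢v , _ with neighbour-avoiding G deg3 u v w
  ... | x , ux , x≢v , x≢w =
    m′ , l′ , ~-sym (middle~link S′[v]≡b) , IsMiddle⇒⟦middle⟧ isM , middle~link S′[x] ,
    ~-sym (middle~link refl) , IsMiddle⇒⟦middle⟧ isM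
    where
      S′ = toggle (toggle S v) w
      m′ = mV u S′ (toggle₂-even G S pS q uw)
      l′ = link (lookup S x) u x ux
      S′[v]≡b : lookup S′ v ≡ b
      S′[v]≡b = trans (lookup-toggle′ (toggle S v) (w≢v ∘ sym))
                      (trans (lookup-toggle S v) (sym (¬-not (S[v]≢b ∘ sym))))
      S′[x] : lookup S′ x ≡ lookup S x
      S′[x] = trans (lookup-toggle′ (toggle S v) x≢w) (lookup-toggle′ S x≢v)

  link-inGadget-middle : ∀ {l h} → IsLink l → IsMiddle h → gadget l ≡ gadget h → ⟦inGadget⟧ l h
  link-inGadget-middle isA isM refl = link-inGadget true _ _
  link-inGadget-middle isB isM refl = link-inGadget false _ _

  links-sameColor : ∀ {x y} → IsLink x → IsLink y → gadget x ≡ gadget y → peer x ≡ peer y → SameColor G x y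
  links-sameColor isA isA gx≡gy px≡py = gx≡gy , px≡py
  links-sameColor isA isB gx≡gy px≡py = gx≡gy , px≡py
  links-sameColor isB isA gx≡gy px≡py = gx≡gy , px≡py
  links-sameColor isB isB gx≡gy px≡py = gx≡gy , px≡py

  middles-sameColor : ∀ {x y} → IsMiddle x → IsMiddle y → gadget x ≡ gadget y → SameColor G x y
  middles-sameColor isM isM gx≡gy = gx≡gy

  sameColor-cases : ∀ x y → SameColor G x y →
                    (IsLink x × IsLink y × gadget x ≡ gadget y × peer x ≡ peer y)
                    ⊎ (IsMiddle x × IsMiddle y × gadget x ≡ gadget y)
  sameColor-cases (aV _ _ _) (aV _ _ _) (gx≡gy , px≡py) = inj₁ (isA , isA , gx≡gy , px≡py)
  sameColor-cases (aV _ _ _) (bV _ _ _) (gx≡gy , px≡py) = inj₁ (isA , isB , gx≡gy , px≡py)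
  sameColor-cases (bV _ _ _) (aV _ _ _) (gx≡gy , px≡py) = inj₁ (isB , isA , gx≡gy , px≡py)
  sameColor-cases (bV _ _ _) (bV _ _ _) (gx≡gy , px≡py) = inj₁ (isB , isB , gx≡gy , px≡py)
  sameColor-cases (mV _ _ _) (mV _ _ _) gx≡gy           = inj₂ (isM , isM , gx≡gy)

  hub : Fin (n G) → V
  hub u = mV u ∅ (∅-even G u)

  sameLinkColor-intro : ∀ {x y} → IsLink x → IsLink y → gadget x ≡ gadget y → peer x ≡ peer y →
                        ⟦sameLinkColor⟧ x y
  sameLinkColor-intro {x} lx ly gx≡gy px≡py with partner lx | partner ly
  ... | p , x~p , lp , gp≡px | q , y~q , lq , gq≡py =
    IsLink⇒⟦link⟧ lx , IsLink⇒⟦link⟧ ly ,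
    (hub (gadget x) , link-inGadget-middle lx isM refl , link-inGadget-middle ly isM (sym gx≡gy)) ,
    (p , q , hub (gadget p) , x~p , IsLink⇒⟦link⟧ lp , y~q , IsLink⇒⟦link⟧ lq ,
     link-inGadget-middle lp isM refl ,
     link-inGadget-middle lq isM (trans gq≡py (trans (sym px≡py) (sym gp≡px))))

  sameMiddleColor-intro : ∀ {x y} → IsMiddle x → IsMiddle y → gadget x ≡ gadget y → ⟦sameMiddleColor⟧ x y
  sameMiddleColor-intro (isM {u} {S} {pS}) (isM {S = S′}) refl with neighbour G deg3 u
  ... | v , uv =
    IsMiddle⇒⟦middle⟧ isM , IsMiddle⇒⟦middle⟧ isM ,
    link (lookup S v) u v uv , link (lookup S′ v) u v uv , mV u S pS ,
    middle~link refl , middle~link refl , link-inGadget _ uv pS , link-inGadget _ uv pS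

  ⟦sameLinkColor⟧⇒SameColor : ∀ {x y} → ⟦sameLinkColor⟧ x y → SameColor G x y
  ⟦sameLinkColor⟧⇒SameColor {x} {y} (lx , ly , (h , x∈h , y∈h) , (p , q , h′ , x~p , lp , y~q , lq , p∈h′ , q∈h′)) =
    links-sameColor Lx Ly (trans (⟦inGadget⟧⇒≡gadget x∈h) (sym (⟦inGadget⟧⇒≡gadget y∈h))) same-peer
    where
      Lx = ⟦link⟧⇒IsLink lx
      Ly = ⟦link⟧⇒IsLink ly
      same-peer : peer x ≡ peer y
      same-peer = begin
        peer x    ≡⟨ proj₁ (link~link Lx (⟦link⟧⇒IsLink lp) x~p) ⟨
        gadget p  ≡⟨ ⟦inGadget⟧⇒≡gadget p∈h′ ⟩
        gadget h′ ≡⟨ ⟦inGadget⟧⇒≡gadget q∈h′ ⟨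
        gadget q  ≡⟨ proj₁ (link~link Ly (⟦link⟧⇒IsLink lq) y~q) ⟩
        peer y    ∎
        where open ≡-Reasoning

  ⟦sameMiddleColor⟧⇒SameColor : ∀ {x y} → ⟦sameMiddleColor⟧ x y → SameColor G x y
  ⟦sameMiddleColor⟧⇒SameColor {x} {y} (mx , my , l , l′ , h , x~l , y~l′ , l∈h , l′∈h) =
    middles-sameColor Mx My (begin
      gadget x  ≡⟨ proj₂ (middle-neighbour Mx x~l) ⟨
      gadget l  ≡⟨ ⟦inGadget⟧⇒≡gadget l∈h ⟩
      gadget h  ≡⟨ ⟦inGadget⟧⇒≡gadget l′∈h ⟨
      gadget l′ ≡⟨ proj₂ (middle-neighbour My y~l′) ⟩
      gadget y  ∎)
    where
      open ≡-Reasoning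
      Mx = ⟦middle⟧⇒IsMiddle mx
      My = ⟦middle⟧⇒IsMiddle my

  sameColorᶠ-defines-SameColor : ∀ x y → Sat Ỹ sameColorᶠ (env2 x y) ⇔ SameColor G x y
  sameColorᶠ-defines-SameColor x y =
    subst (_⇔ SameColor G x y) (sym (Sat-sameColor x y)) (mk⇔ to from)
    where
      to : ⟦sameLinkColor⟧ x y ⊎ ⟦sameMiddleColor⟧ x y → SameColor G x y
      to = [ ⟦sameLinkColor⟧⇒SameColor , ⟦sameMiddleColor⟧⇒SameColor ]′
      from : SameColor G x y → ⟦sameLinkColor⟧ x y ⊎ ⟦sameMiddleColor⟧ x y
      from c with sameColor-cases x y c
      ... | inj₁ (lx , ly , gx≡gy , px≡py) = inj₁ (sameLinkColor-intro lx ly gx≡gy px≡py)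
      ... | inj₂ (mx , my , gx≡gy)         = inj₂ (sameMiddleColor-intro mx my gx≡gy)

theorem9p3 : Σ (Formula 2) (λ sameColor →
    (G : Graph) → 2 ≤ n G → Connected G → MinDegree3 G →
      ((x y : YVertex G) → Sat (Y G) sameColor (env2 x y) ⇔ SameColor G x y)
      × ((u0 v0 : Fin (n G)) → T (adj G u0 v0) → (x y : YVertex G) →
           Sat (Ytilde G u0 v0) sameColor (env2 x y) ⇔ SameColor G x y))
theorem9p3 = sameColorᶠ , λ G _ _ deg3 →
  CFI.sameColorᶠ-defines-SameColor G deg3 nothing ,
  λ u₀ v₀ _ → CFI.sameColorᶠ-defines-SameColor G deg3 (just (u₀ , v₀))
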